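{- Let $\widetilde X=(f,G,Z,\mathrm{id})$ be a map, $H\trianglelefteq G$ a normal subgroup, and $X=\widetilde X\triangle H$ the monodromy quotient induced by $H$, with monodromy quotient projection $(p,q)$, where $p(z)=[z]$ and $q:G\to G/H$ is natural. Then every $\widetilde a\in\mathrm{Aut}(\widetilde X)$ projects, i.e. there exists $a\in\mathrm{Aut}(X)$ with $p\circ\widetilde a=a\circ p$. In particular, if for some $W\in F$ the map $\widetilde X$ contains $\alpha_W$, then $X$ also contains $\alpha_W$.
   Context: Let $F=\langle t,l,r\mid t^2=l^2=r^2=(tl)^2=1\rangle$. A (finite rooted) map is a quadruple $M=(f,G,Z,\mathrm{id})$, where $Z$ is a finite set of flags, $G$ is a group acting on $Z$ on the right, transitively and faithfully, $f:F\to G$ is a group epimorphism, and $\mathrm{id}\in Z$ is the root. An automorphism of $M$ is a bijection $\alpha:Z\to Z$ with $\alpha(z\cdot g)=\alpha(z)\cdot g$ for all $z\in Z$, $g\in G$ (it need not fix the root); they form the group $\mathrm{Aut}(M)$. For $W\in F$, $M$ contains $\alpha_W$ if there is an automorphism of $M$ mapping $\mathrm{id}$ to $\mathrm{id}\cdot f(W)$. Monodromy quotient: for $H\trianglelefteq G$, let $Z/H$ be the set of $H$-orbits $[z]$ on $Z$, $q:G\to G/H$ natural, $G/H$ acting by $[z]\cdot Hg=[z\cdot g]$; then $M\triangle H=(q\circ f,G/H,Z/H,[\mathrm{id}])$, which is a map. -}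

module Defs where

open import Level using (Level; _⊔_) renaming (suc to lsuc)
open import Algebra.Bundles using (Group)
open import Data.Nat using (ℕ)
open import Data.Fin using (Fin)
open import Data.List using (List; []; _∷_)
open import Data.Product using (Σ; ∃; ∃-syntax; _×_; _,_)
open import Relation.Binary.Bundles using (Setoid)
open import Relation.Binary.PropositionalEquality as ≡ using (_≡_)
open import Function.Bundles using (Bijection)

-- The group F = ⟨ t , l , r ∣ t² = l² = r² = (tl)² = 1 ⟩.
-- Since every generator is an involution, every element of F is
-- represented by a (positive) word in the letters t, l, r.  We represent
-- elements W ∈ F by such words; a homomorphism F → G is then given by
-- images of t, l, r satisfying the defining relations, and evaluation
-- of words.

data Gen : Set where
  t l r : Gen

Word : Set
Word = List Gen

module _ {c ℓ} (G : Group c ℓ) where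
  open Group G

  evalWord : (ft fl fr : Carrier) → Word → Carrier
  evalWord ft fl fr []      = ε
  evalWord ft fl fr (t ∷ w) = ft ∙ evalWord ft fl fr w
  evalWord ft fl fr (l ∷ w) = fl ∙ evalWord ft fl fr w
  evalWord ft fl fr (r ∷ w) = fr ∙ evalWord ft fl fr w

  record NormalSubgroup (p : Level) : Set (c ⊔ ℓ ⊔ lsuc p) where
    field
      H      : Carrier → Set p
      H-resp : ∀ {x y} → x ≈ y → H x → H y
      H-ε    : H ε
      H-∙    : ∀ {x y} → H x → H y → H (x ∙ y)
      H-⁻¹   : ∀ {x} → H x → H (x ⁻¹)
      normal : ∀ g {h} → H h → H ((g ⁻¹ ∙ h) ∙ g)

-- Finite rooted maps  M = (f , G , Z , id).

record Map (c ℓ : Level) : Set (lsuc (c ⊔ ℓ)) where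
  field
    G      : Group c ℓ
    nFlags : ℕ
  open Group G
  Z : Set
  Z = Fin nFlags
  field
    _·_        : Z → Carrier → Z
    ·-cong     : ∀ z {g h} → g ≈ h → z · g ≡ z · h
    ·-identity : ∀ z → z · ε ≡ z
    ·-assoc    : ∀ z g h → z · (g ∙ h) ≡ (z · g) · h
    transitive : ∀ z z′ → ∃[ g ] (z · g ≡ z′)
    faithful   : ∀ g → (∀ z → z · g ≡ z) → g ≈ ε
    fₜ fₗ fᵣ    : Carrier
    rel-t      : fₜ ∙ fₜ ≈ ε
    rel-l      : fₗ ∙ fₗ ≈ ε
    rel-r      : fᵣ ∙ fᵣ ≈ ε
    rel-tl     : (fₜ ∙ fₗ) ∙ (fₜ ∙ fₗ) ≈ ε
    f-epi      : ∀ g → ∃[ w ] (evalWord G fₜ fₗ fᵣ w ≈ g)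
    root       : Z

  f : Word → Carrier
  f = evalWord G fₜ fₗ fᵣ

-- The data of a rooted map needed for automorphisms and for α_W:
-- a setoid of flags, the acting elements (of type A), the right action,
-- the image f(W) of words, and the root.

record RootedAction (a z ℓz : Level) : Set (lsuc (a ⊔ z ⊔ ℓz)) where
  field
    Acts   : Set a
    Flags  : Setoid z ℓz
  open Setoid Flags renaming (Carrier to Flag; _≈_ to _≈F_)
  field
    _·_    : Flag → Acts → Flag
    ·-cong : ∀ {x y} g → x ≈F y → (x · g) ≈F (y · g)
    f      : Word → Acts
    root   : Flag

module _ {a z ℓz} (M : RootedAction a z ℓz) where
  open RootedAction M
  open Setoid Flags renaming (Carrier to Flag; _≈_ to _≈F_)

  record Automorphism : Set (a ⊔ z ⊔ ℓz) where
    field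
      bij      : Bijection Flags Flags
    open Bijection bij public using (to)
    field
      commutes : ∀ x g → to (x · g) ≈F (to x · g)

  Contains : Word → Set (a ⊔ z ⊔ ℓz)
  Contains W = Σ Automorphism λ α → Automorphism.to α root ≈F (root · f W)

module _ {c ℓ} (M : Map c ℓ) where
  open Map M
  open Group G using (Carrier)

  asAction : RootedAction c Level.zero Level.zero
  asAction = record
    { Acts   = Carrier
    ; Flags  = ≡.setoid Z
    ; _·_    = _·_
    ; ·-cong = λ g eq → ≡.cong (λ x → x · g) eq
    ; f      = f
    ; root   = root
    }

  Aut : Set c
  Aut = Automorphism asAction

-- Flags: the H-orbits [z] = { z · h ∣ h ∈ H }, realised as the setoid on Z
-- with z ∼ z′ iff z · h ≡ z′ for some h ∈ H (so p(z) = [z] is the identity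
-- on representatives).  G/H acts by [z] · Hg = [z · g]; an element Hg of
-- G/H is represented by g ∈ G, and q(g) = Hg, so (q ∘ f)(W) is represented
-- by f(W).

module _ {c ℓ p} (M : Map c ℓ) (N : NormalSubgroup (Map.G M) p) where
  open Map M
  open Group G
  open NormalSubgroup N

  _∼_ : Z → Z → Set (c ⊔ p)
  x ∼ y = ∃[ h ] (H h × x · h ≡ y)

  private
    ∼-refl : ∀ {x} → x ∼ x
    ∼-refl {x} = ε , H-ε , ·-identity x

    ∼-sym : ∀ {x y} → x ∼ y → y ∼ x
    ∼-sym {x} {y} (h , Hh , eq) = h ⁻¹ , H-⁻¹ Hh ,
      ≡.trans (≡.cong (λ u → u · (h ⁻¹)) (≡.sym eq))
        (≡.trans (≡.sym (·-assoc x h (h ⁻¹)))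
          (≡.trans (·-cong x (inverseʳ h)) (·-identity x)))

    ∼-trans : ∀ {x y w} → x ∼ y → y ∼ w → x ∼ w
    ∼-trans {x} (h , Hh , eq) (k , Hk , eq′) = h ∙ k , H-∙ Hh Hk ,
      ≡.trans (·-assoc x h k) (≡.trans (≡.cong (λ u → u · k) eq) eq′)

  orbitSetoid : Setoid Level.zero (c ⊔ p)
  orbitSetoid = record
    { Carrier       = Z
    ; _≈_           = _∼_
    ; isEquivalence = record { refl = ∼-refl ; sym = ∼-sym ; trans = ∼-trans }
    }

  _△_ : RootedAction c Level.zero (c ⊔ p)
  _△_ = record
    { Acts   = Carrier
    ; Flags  = orbitSetoid
    ; _·_    = _·_
    ; ·-cong = λ {x} {y} g x∼y → cong′ g x∼y
    ; f      = f
    ; root   = root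
    }
    where
      cong′ : ∀ {x y} g → x ∼ y → (x · g) ∼ (y · g)
      cong′ {x} {y} g (h , Hh , eq) = (g ⁻¹ ∙ h) ∙ g , normal g Hh ,
        ≡.trans (≡.sym (·-assoc x g _))
          (≡.trans (·-cong x lemma)
            (≡.trans (·-assoc x h g) (≡.cong (λ u → u · g) eq)))
        where
          open import Relation.Binary.Reasoning.Setoid setoid
          lemma : g ∙ ((g ⁻¹ ∙ h) ∙ g) ≈ h ∙ g
          lemma = begin
            g ∙ ((g ⁻¹ ∙ h) ∙ g) ≈⟨ sym (assoc g (g ⁻¹ ∙ h) g) ⟩
            (g ∙ (g ⁻¹ ∙ h)) ∙ g ≈⟨ ∙-congʳ (sym (assoc g (g ⁻¹) h)) ⟩
            ((g ∙ g ⁻¹) ∙ h) ∙ g ≈⟨ ∙-congʳ (∙-congʳ (inverseʳ g)) ⟩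
            (ε ∙ h) ∙ g          ≈⟨ ∙-congʳ (identityˡ h) ⟩
            h ∙ g                ∎

{-# OPTIONS --safe #-}
module Submission where

-- An automorphism commutes with the whole monodromy group, in particular with
-- H, so it maps the orbit z · H onto the orbit of its image and thus induces a
-- bijection of H-orbits that still commutes with the action.  The induced
-- automorphism agrees with the original one on representatives, so it sends
-- [root] to [root · f W] whenever the original sends root to root · f W.

open import Defs
open import Level using (Level)
open import Data.Product using (Σ; _×_; _,_)
open import Relation.Binary.PropositionalEquality as ≡ using (_≡_)
open import Algebra.Bundles using (Group)
open import Function.Bundles using (Bijection)

module _ {c ℓ p : Level} (X̃ : Map c ℓ) (N : NormalSubgroup (Map.G X̃) p) where
  open Map X̃
  open Group G using (ε)
  open NormalSubgroup N
  open Automorphism using (to; commutes)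

  private
    infix 4 _∼ᴴ_
    _∼ᴴ_ : Z → Z → Set _
    _∼ᴴ_ = _∼_ X̃ N

  ≡⇒∼ : ∀ {x y} → x ≡ y → x ∼ᴴ y
  ≡⇒∼ x≡y = ε , H-ε , ≡.trans (·-identity _) x≡y

  Aut-resp-∼ : (ã : Aut X̃) → ∀ {x y} → x ∼ᴴ y → to ã x ∼ᴴ to ã y
  Aut-resp-∼ ã {x} (h , Hh , x·h≡y) =
    h , Hh , ≡.trans (≡.sym (commutes ã x h)) (≡.cong (to ã) x·h≡y)

  Aut-reflects-∼ : (ã : Aut X̃) → ∀ {x y} → to ã x ∼ᴴ to ã y → x ∼ᴴ y
  Aut-reflects-∼ ã {x} (h , Hh , ãx·h≡ãy) =
    h , Hh , Bijection.injective (Automorphism.bij ã)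
               (≡.trans (commutes ã x h) ãx·h≡ãy)

  project : Aut X̃ → Automorphism (X̃ △ N)
  project ã = record
    { bij      = record
      { to        = to ã
      ; cong      = Aut-resp-∼ ã
      ; bijective = Aut-reflects-∼ ã , surjective
      }
    ; commutes = λ x g → ≡⇒∼ (commutes ã x g)
    }
    where
      surjective : ∀ y → Σ Z λ x → ∀ {z} → z ∼ᴴ x → to ã z ∼ᴴ y
      surjective y with Bijection.surjective (Automorphism.bij ã) y
      ... | x , ãx≡y = x , λ {z} z∼x →
        ≡.subst (to ã z ∼ᴴ_) (ãx≡y ≡.refl) (Aut-resp-∼ ã z∼x)

proposition5 : ∀ {c ℓ p : Level} (X̃ : Map c ℓ) (N : NormalSubgroup (Map.G X̃) p)
    → (∀ (ã : Aut X̃) → Σ (Automorphism (X̃ △ N)) λ a →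
         ∀ z → _∼_ X̃ N (Automorphism.to ã z) (Automorphism.to a z))
    × (∀ (W : Word) → Contains (asAction X̃) W → Contains (X̃ △ N) W)
proposition5 X̃ N =
    (λ ã → project X̃ N ã , λ _ → ≡⇒∼ X̃ N ≡.refl)
  , λ W (ã , ãroot≡root·fW) → project X̃ N ã , ≡⇒∼ X̃ N ãroot≡root·fW
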